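{- The generating function $C(x,y,z,u)$ satisfies \[ C(x,y,z,u)=xyu+\frac{xyu}{1-yu}\Bigl(C(x,z,y,1)-yu\, C(x,z,y,yu)\Bigr). \]
   Context: A Catalan word of length $n\geq1$ is a sequence $w_1\cdots w_n$ of nonnegative integers with $w_1=0$ and $w_i\leq w_{i-1}+1$; its Catalan polyomino is the bargraph whose $i$th column has $w_i+1$ cells, columns bottom-aligned; $\mathbf{C}$ is the set of all Catalan polyominoes (with at least one column). For $P\in\mathbf{C}$: $\mathrm{lth}(P)$ = number of columns, $\mathrm{last}(P)$ = number of cells in the last column, $\mathrm{ver}(P)$ = total number of cells in columns of odd index (first column index 1), $\mathrm{white}(P)$ = total number of cells in columns of even index. Define $s(P)=\mathrm{ver}(P)$ if $\mathrm{lth}(P)$ is odd and $s(P)=\mathrm{white}(P)$ if $\mathrm{lth}(P)$ is even; and $\bar s(P)=\mathrm{ver}(P)$ if $\mathrm{lth}(P)$ is even and $\bar s(P)=\mathrm{white}(P)$ if $\mathrm{lth}(P)$ is odd. $C(x,y,z,u)=\sum_{P\in\mathbf{C}}x^{\mathrm{lth}(P)}y^{s(P)}z^{\bar s(P)}u^{\mathrm{last}(P)}$. -}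

module Defs where

open import Level using (Level)
open import Data.Bool using (Bool; true; false; _∧_; if_then_else_)
open import Data.Nat using (ℕ; zero; suc; _≤ᵇ_; _≡ᵇ_)
open import Data.List using (List; []; _∷_; map; concatMap; upTo; filterᵇ; length; foldr)
open import Algebra.Bundles using (CommutativeRing)

-- Catalan words, represented as lists of naturals  w₁ ⋯ wₙ.
-- A Catalan polyomino is determined by (and identified with) its
-- Catalan word: column i has wᵢ + 1 cells.

catFrom : ℕ → List ℕ → Bool
catFrom p []       = true
catFrom p (w ∷ ws) = (w ≤ᵇ suc p) ∧ catFrom w ws

isCatalan : List ℕ → Bool
isCatalan []       = false
isCatalan (w ∷ ws) = (w ≡ᵇ 0) ∧ catFrom w ws

allWords : ℕ → ℕ → List (List ℕ)
allWords zero    m = [] ∷ []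
allWords (suc k) m = concatMap (λ v → map (v ∷_) (allWords k m)) (upTo m)

-- all Catalan words of length n (their entries are automatically < n)
catalanWords : ℕ → List (List ℕ)
catalanWords n = filterᵇ isCatalan (allWords n n)

lth : List ℕ → ℕ
lth = length

last : List ℕ → ℕ
last []           = 0
last (w ∷ [])     = suc w
last (_ ∷ v ∷ ws) = last (v ∷ ws)

-- ver = cells in columns of odd index (first column has index 1),
-- white = cells in columns of even index
ver white : List ℕ → ℕ
ver []         = 0
ver (w ∷ ws)   = suc w Data.Nat.+ white ws
white []       = 0
white (w ∷ ws) = ver ws

isOdd : ℕ → Bool
isOdd zero    = false
isOdd (suc n) = if isOdd n then false else true

s sbar : List ℕ → ℕ
s    w = if isOdd (lth w) then ver w else white w
sbar w = if isOdd (lth w) then white w else ver w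

-- Coefficients of C(x,y,z,u) with respect to x, evaluated in an
-- arbitrary commutative ring:
--   Ccoeff R n y z u = [xⁿ] C(x,y,z,u)
--                    = Σ_{P ∈ C, lth P = n} y^{s P} z^{s̄ P} u^{last P}.
-- (C(x,y,z,u) = Σₙ Ccoeff n y z u xⁿ.)

module _ {c ℓ : Level} (R : CommutativeRing c ℓ) where
  open CommutativeRing R

  pow : Carrier → ℕ → Carrier
  pow a zero    = 1#
  pow a (suc n) = a * pow a n

  Ccoeff : ℕ → Carrier → Carrier → Carrier → Carrier
  Ccoeff n y z u =
    foldr _+_ 0# (map (λ w → pow y (s w) * (pow z (sbar w) * pow u (last w)))
                      (catalanWords n))

  -- [xⁿ⁺¹] (x y u) : equals y u when n = 0, and 0 otherwise
  xyuCoeff : ℕ → Carrier → Carrier → Carrier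
  xyuCoeff zero    y u = y * u
  xyuCoeff (suc n) y u = 0#

{-# OPTIONS --safe #-}
-- Removing the last column of a Catalan polyomino P′ of length n + 2 leaves a
-- Catalan polyomino P of length n + 1, and the removed column may have any height
-- j ∈ {1, …, last P + 1}.  The parity of the length flips, so s P′ = s̄ P + j and
-- s̄ P′ = s P; summing (y u)ʲ over j gives y u (1 − (y u)^(last P + 1)) / (1 − y u),
-- which is the functional equation coefficientwise (the single column of length 1
-- gives the term x y u).  Since Catalan words are enumerated from their first
-- letter, the identity is proved for sums over all continuations of a column
-- (catFromSum), by induction on their length, in the division-free form
-- ColumnEquation that makes sense in any commutative semiring.
module Submission where

open import Defs
open import Algebra.Bundles using (CommutativeRing; CommutativeSemiring)
open import Data.Bool using (Bool; true; false; if_then_else_; _∧_; T)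
open import Data.Fin using (toℕ; fromℕ; inject₁)
open import Data.Fin.Properties using (toℕ-inject₁; toℕ-fromℕ)
open import Data.List using (List; []; _∷_; _++_; map; concatMap; applyUpTo; upTo; foldr; filterᵇ; length)
open import Data.List.Properties using (map-∘; map-cong)
open import Data.List.Relation.Unary.All as All using (All; []; _∷_)
open import Data.List.Relation.Unary.All.Properties using (concat⁺; map⁺; applyUpTo⁺₂)
open import Data.Nat as ℕ using (ℕ; zero; suc; _≤ᵇ_; _<_; s≤s)
open import Data.Nat.Properties using (≤-refl; ≤-trans; ≤ᵇ⇒≤; +-suc; +-monoˡ-≤; m≤m+n)
open import Data.Product using (_×_; _,_)
open import Data.Unit using (tt)
open import Data.Vec.Functional using (Vector; tail)
open import Function using (id; _∘_)
import Relation.Binary.PropositionalEquality as ≡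
open ≡ using (_≡_)

ifEven : ∀ {a} {A : Set a} → ℕ → A → A → A
ifEven zero    x y = x
ifEven (suc k) x y = ifEven k y x

ifEven-isOdd : ∀ {a} {A : Set a} k (x y : A) → ifEven k x y ≡ (if isOdd k then y else x)
ifEven-isOdd zero    x y = ≡.refl
ifEven-isOdd (suc k) x y rewrite ifEven-isOdd k y x with isOdd k
... | true  = ≡.refl
... | false = ≡.refl

suc≤ᵇsuc : ∀ m n → (suc m ≤ᵇ suc n) ≡ (m ≤ᵇ n)
suc≤ᵇsuc zero    n = ≡.refl
suc≤ᵇsuc (suc m) n = ≡.refl

allWords-length : ∀ k m → All (λ ws → length ws ≡ k) (allWords k m)
allWords-length zero    m = ≡.refl ∷ []
allWords-length (suc k) m =
  concat⁺ (map⁺ (applyUpTo⁺₂ id m (λ _ → map⁺ (All.map (≡.cong suc) (allWords-length k m)))))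

module CatalanSums {c ℓ} (R : CommutativeSemiring c ℓ) where
  open CommutativeSemiring R hiding (zero)
  open import Algebra.Properties.Semiring.Sum semiring
  open import Algebra.Properties.Semiring.Exp semiring using (_^_; ^-homo-*)
  open import Algebra.Properties.CommutativeSemiring.Exp R using (^-distrib-*)
  open import Algebra.Solver.Ring.NaturalCoefficients.Default R
  open import Relation.Binary.Reasoning.Setoid setoid

  sumList : {A : Set} → (A → Carrier) → List A → Carrier
  sumList f xs = foldr _+_ 0# (map f xs)

  sumWhere : {A : Set} → (A → Bool) → (A → Carrier) → List A → Carrier
  sumWhere Q f = sumList (λ x → if Q x then f x else 0#)

  sumList-0# : {A : Set} (xs : List A) → sumList (λ _ → 0#) xs ≈ 0#
  sumList-0# []       = refl
  sumList-0# (_ ∷ xs) = trans (+-identityˡ _) (sumList-0# xs)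

  sumList-++ : {A : Set} (f : A → Carrier) (xs ys : List A) →
    sumList f (xs ++ ys) ≈ sumList f xs + sumList f ys
  sumList-++ f []       ys = sym (+-identityˡ _)
  sumList-++ f (x ∷ xs) ys = trans (+-congˡ (sumList-++ f xs ys)) (sym (+-assoc _ _ _))

  sumList-concatMap : {A B : Set} (f : B → Carrier) (g : A → List B) (xs : List A) →
    sumList f (concatMap g xs) ≈ sumList (λ x → sumList f (g x)) xs
  sumList-concatMap f g []       = refl
  sumList-concatMap f g (x ∷ xs) =
    trans (sumList-++ f (g x) (concatMap g xs)) (+-congˡ (sumList-concatMap f g xs))

  sumList-map : {A B : Set} (f : B → Carrier) (g : A → B) (xs : List A) →
    sumList f (map g xs) ≡ sumList (f ∘ g) xs
  sumList-map f g xs = ≡.cong (foldr _+_ 0#) (≡.sym (map-∘ xs))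

  sumList-applyUpTo : {A : Set} (f : A → Carrier) (g : ℕ → A) (m : ℕ) →
    sumList f (applyUpTo g m) ≡ ∑[ i < m ] f (g (toℕ i))
  sumList-applyUpTo f g zero    = ≡.refl
  sumList-applyUpTo f g (suc m) = ≡.cong (f (g 0) +_) (sumList-applyUpTo f (g ∘ suc) m)

  sumList-filterᵇ : {A : Set} (Q : A → Bool) (f : A → Carrier) (xs : List A) →
    sumList f (filterᵇ Q xs) ≈ sumWhere Q f xs
  sumList-filterᵇ Q f []       = refl
  sumList-filterᵇ Q f (x ∷ xs) with Q x
  ... | true  = +-congˡ (sumList-filterᵇ Q f xs)
  ... | false = trans (sumList-filterᵇ Q f xs) (sym (+-identityˡ _))

  sumWhere-cong : {A : Set} (Q : A → Bool) {f g : A → Carrier} {xs : List A} →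
    All (λ x → f x ≈ g x) xs → sumWhere Q f xs ≈ sumWhere Q g xs
  sumWhere-cong Q []                           = refl
  sumWhere-cong Q {xs = x ∷ _} (fx≈gx ∷ f≈g) with Q x
  ... | true  = +-cong fx≈gx (sumWhere-cong Q f≈g)
  ... | false = +-congˡ (sumWhere-cong Q f≈g)

  sumWhere-*ˡ : {A : Set} (Q : A → Bool) (a : Carrier) (f : A → Carrier) (xs : List A) →
    sumWhere Q (λ x → a * f x) xs ≈ a * sumWhere Q f xs
  sumWhere-*ˡ Q a f []       = sym (zeroʳ a)
  sumWhere-*ˡ Q a f (x ∷ xs) with Q x
  ... | true  = trans (+-congˡ (sumWhere-*ˡ Q a f xs)) (sym (distribˡ a _ _))
  ... | false = trans (+-congˡ (sumWhere-*ˡ Q a f xs))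
                      (trans (+-identityˡ _) (*-congˡ (sym (+-identityˡ _))))

  sumList-allWords : (F : List ℕ → Carrier) (k m : ℕ) →
    sumList F (allWords (suc k) m) ≈ ∑[ v < m ] sumList (λ ws → F (toℕ v ∷ ws)) (allWords k m)
  sumList-allWords F k m = begin
    sumList F (allWords (suc k) m)
      ≈⟨ sumList-concatMap F (λ v → map (v ∷_) (allWords k m)) (upTo m) ⟩
    sumList (λ v → sumList F (map (v ∷_) (allWords k m))) (upTo m)
      ≡⟨ sumList-applyUpTo _ id m ⟩
    ∑[ v < m ] sumList F (map (toℕ v ∷_) (allWords k m))
      ≡⟨ sum-cong-≗ {m} (λ v → sumList-map F (toℕ v ∷_) (allWords k m)) ⟩
    ∑[ v < m ] sumList (λ ws → F (toℕ v ∷ ws)) (allWords k m) ∎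

  ∑-truncate : ∀ {q m} → q < m → (g : ℕ → Carrier) →
    ∑[ v < m ] (if toℕ v ≤ᵇ q then g (toℕ v) else 0#) ≈ ∑[ v < suc q ] g (toℕ v)
  ∑-truncate {zero}  {suc m} _         g = +-congˡ (sum-replicate-zero m)
  ∑-truncate {suc q} {suc m} (s≤s q<m) g = +-congˡ (begin
    ∑[ v < m ] (if suc (toℕ v) ≤ᵇ suc q then g (suc (toℕ v)) else 0#)
      ≡⟨ sum-cong-≗ {m} (λ v →
           ≡.cong (λ b → if b then g (suc (toℕ v)) else 0#) (suc≤ᵇsuc (toℕ v) q)) ⟩
    ∑[ v < m ] (if toℕ v ≤ᵇ q then g (suc (toℕ v)) else 0#)
      ≈⟨ ∑-truncate q<m (g ∘ suc) ⟩
    ∑[ v < suc q ] g (suc (toℕ v)) ∎)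

  catalanWeight : Carrier → Carrier → Carrier → List ℕ → Carrier
  catalanWeight y z u w = y ^ s w * (z ^ sbar w * u ^ last w)

  catalanSum : ℕ → Carrier → Carrier → Carrier → Carrier
  catalanSum n y z u = sumList (catalanWeight y z u) (catalanWords n)

  catFromWeight : Carrier → Carrier → Carrier → ℕ → List ℕ → Carrier
  catFromWeight y z u p ws = y ^ s ws * (z ^ sbar ws * u ^ last (p ∷ ws))

  catFromWeight-∷ : ∀ y z u p v {k ws} → length ws ≡ k →
    catFromWeight y z u p (v ∷ ws) ≈ ifEven k y z ^ suc v * catFromWeight y z u v ws
  catFromWeight-∷ y z u p v {ws = ws} ≡.refl
    rewrite ifEven-isOdd (length ws) y z
    with isOdd (length ws)
  ... | false = trans (*-congʳ (^-homo-* y (suc v) (white ws))) (*-assoc _ _ _)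
  ... | true  = trans (*-congˡ (*-congʳ (^-homo-* z (suc v) (white ws))))
    (solve 4 (λ Y Z₁ Z₂ U → Y :* ((Z₁ :* Z₂) :* U) := Z₁ :* (Y :* (Z₂ :* U))) refl _ _ _ _)

  -- A column followed by k further columns counts towards s exactly when k is even.
  catFromSum : ℕ → ℕ → Carrier → Carrier → Carrier → Carrier
  catFromSum zero    p y z u = u ^ suc p
  catFromSum (suc k) p y z u =
    ∑[ v < suc (suc p) ] (ifEven k y z ^ suc (toℕ v) * catFromSum k (toℕ v) y z u)

  sumWhere-catFromWeight-∷ : ∀ y z u p v k m →
    sumWhere (catFrom v) (λ ws → catFromWeight y z u p (v ∷ ws)) (allWords k m)
      ≈ ifEven k y z ^ suc v * sumWhere (catFrom v) (catFromWeight y z u v) (allWords k m)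
  sumWhere-catFromWeight-∷ y z u p v k m = trans
    (sumWhere-cong (catFrom v)
      (All.map (λ {ws} → catFromWeight-∷ y z u p v {ws = ws}) (allWords-length k m)))
    (sumWhere-*ˡ (catFrom v) _ (catFromWeight y z u v) (allWords k m))

  sumWhere-catFrom : ∀ k p m → p ℕ.+ k < m → ∀ y z u →
    sumWhere (catFrom p) (catFromWeight y z u p) (allWords k m) ≈ catFromSum k p y z u
  sumWhere-catFrom zero    p m _ y z u =
    trans (+-identityʳ _) (trans (*-identityˡ _) (*-identityˡ _))
  sumWhere-catFrom (suc k) p m p+k<m y z u = begin
    sumWhere (catFrom p) (catFromWeight y z u p) (allWords (suc k) m)
      ≈⟨ sumList-allWords _ k m ⟩
    ∑[ v < m ] sumWhere (λ ws → catFrom p (toℕ v ∷ ws))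
                        (λ ws → catFromWeight y z u p (toℕ v ∷ ws)) (allWords k m)
      ≈⟨ sum-cong-≋ {m} (λ v → firstColumn (toℕ v)) ⟩
    ∑[ v < m ] (if toℕ v ≤ᵇ suc p then column (toℕ v) else 0#)
      ≈⟨ ∑-truncate (≤-trans (s≤s (m≤m+n (suc p) k)) bound) column ⟩
    catFromSum (suc k) p y z u ∎
    where
    column : ℕ → Carrier
    column v = ifEven k y z ^ suc v * catFromSum k v y z u

    bound : suc (suc p ℕ.+ k) ℕ.≤ m
    bound = ≡.subst (_< m) (+-suc p k) p+k<m

    firstColumn : ∀ v →
      sumWhere (λ ws → (v ≤ᵇ suc p) ∧ catFrom v ws) (λ ws → catFromWeight y z u p (v ∷ ws)) (allWords k m)
        ≈ (if v ≤ᵇ suc p then column v else 0#)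
    firstColumn v with v ≤ᵇ suc p in v≤ᵇ1+p
    ... | false = sumList-0# (allWords k m)
    ... | true  = begin
      sumWhere (catFrom v) (λ ws → catFromWeight y z u p (v ∷ ws)) (allWords k m)
        ≈⟨ sumWhere-catFromWeight-∷ y z u p v k m ⟩
      ifEven k y z ^ suc v * sumWhere (catFrom v) (catFromWeight y z u v) (allWords k m)
        ≈⟨ *-congˡ (sumWhere-catFrom k v m (≤-trans (s≤s (+-monoˡ-≤ k v≤1+p)) bound) y z u) ⟩
      column v ∎
      where
      v≤1+p : v ℕ.≤ suc p
      v≤1+p = ≤ᵇ⇒≤ v (suc p) (≡.subst T (≡.sym v≤ᵇ1+p) tt)

  catalanSum-suc : ∀ k y z u → catalanSum (suc k) y z u ≈ ifEven k y z * catFromSum k 0 y z u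
  catalanSum-suc k y z u = begin
    catalanSum (suc k) y z u
      ≈⟨ sumList-filterᵇ isCatalan _ (allWords (suc k) (suc k)) ⟩
    sumWhere isCatalan (catalanWeight y z u) (allWords (suc k) (suc k))
      ≈⟨ sumList-allWords _ k (suc k) ⟩
    -- a Catalan word starts with 0
    firstZero + ∑[ v < k ] sumList (λ _ → 0#) (allWords k (suc k))
      ≈⟨ +-congˡ (trans (sum-cong-≋ {k} (λ _ → sumList-0# (allWords k (suc k))))
                        (sum-replicate-zero k)) ⟩
    firstZero + 0#
      ≈⟨ +-identityʳ _ ⟩
    firstZero
      ≈⟨ sumWhere-catFromWeight-∷ y z u 0 0 k (suc k) ⟩
    ifEven k y z ^ 1 * sumWhere (catFrom 0) (catFromWeight y z u 0) (allWords k (suc k))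
      ≈⟨ *-cong (*-identityʳ _) (sumWhere-catFrom k 0 (suc k) ≤-refl y z u) ⟩
    ifEven k y z * catFromSum k 0 y z u ∎
    where
    firstZero = sumWhere (catFrom 0) (λ ws → catFromWeight y z u 0 (0 ∷ ws)) (allWords k (suc k))

  -- (1 − x) X ≈ x (Y − x Z), with both sides moved so that no subtraction occurs.
  ColumnEquation : Carrier → Carrier → Carrier → Carrier → Set ℓ
  ColumnEquation x X Y Z = X + x * (x * Z) ≈ x * Y + x * X

  ColumnEquation-resp : ∀ {x X X′ Y Y′ Z Z′} → X ≈ X′ → Y ≈ Y′ → Z ≈ Z′ →
    ColumnEquation x X Y Z → ColumnEquation x X′ Y′ Z′
  ColumnEquation-resp X≈X′ Y≈Y′ Z≈Z′ eq =
    trans (sym (+-cong X≈X′ (*-congˡ (*-congˡ Z≈Z′))))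
          (trans eq (+-cong (*-congˡ Y≈Y′) (*-congˡ X≈X′)))

  ColumnEquation-*ˡ : ∀ a {x X Y Z} → ColumnEquation x X Y Z →
    ColumnEquation x (a * X) (a * Y) (a * Z)
  ColumnEquation-*ˡ a {x} {X} {Y} {Z} eq = begin
    a * X + x * (x * (a * Z))
      ≈⟨ solve 4 (λ a x X Z → a :* X :+ x :* (x :* (a :* Z)) := a :* (X :+ x :* (x :* Z)))
                 refl a x X Z ⟩
    a * (X + x * (x * Z))
      ≈⟨ *-congˡ eq ⟩
    a * (x * Y + x * X)
      ≈⟨ solve 4 (λ a x X Y → a :* (x :* Y :+ x :* X) := x :* (a :* Y) :+ x :* (a :* X))
                 refl a x X Y ⟩
    x * (a * Y) + x * (a * X) ∎

  ColumnEquation-+ : ∀ {x X Y Z X′ Y′ Z′} → ColumnEquation x X Y Z → ColumnEquation x X′ Y′ Z′ →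
    ColumnEquation x (X + X′) (Y + Y′) (Z + Z′)
  ColumnEquation-+ {x} {X} {Y} {Z} {X′} {Y′} {Z′} eq eq′ = begin
    (X + X′) + x * (x * (Z + Z′))
      ≈⟨ solve 5 (λ x X Z X′ Z′ → (X :+ X′) :+ x :* (x :* (Z :+ Z′))
                                 := (X :+ x :* (x :* Z)) :+ (X′ :+ x :* (x :* Z′))) refl x X Z X′ Z′ ⟩
    (X + x * (x * Z)) + (X′ + x * (x * Z′))
      ≈⟨ +-cong eq eq′ ⟩
    (x * Y + x * X) + (x * Y′ + x * X′)
      ≈⟨ solve 5 (λ x X Y X′ Y′ → (x :* Y :+ x :* X) :+ (x :* Y′ :+ x :* X′)
                                 := x :* (Y :+ Y′) :+ x :* (X :+ X′)) refl x X Y X′ Y′ ⟩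
    x * (Y + Y′) + x * (X + X′) ∎

  ColumnEquation-∑ : ∀ {x n} (X Y Z : Vector Carrier n) →
    (∀ i → ColumnEquation x (X i) (Y i) (Z i)) → ColumnEquation x (sum X) (sum Y) (sum Z)
  ColumnEquation-∑ {x} {zero} X Y Z _ =
    solve 1 (λ x → con 0 :+ x :* (x :* con 0) := x :* con 0 :+ x :* con 0) refl x
  ColumnEquation-∑ {n = suc n} X Y Z eqs =
    ColumnEquation-+ (eqs Data.Fin.zero)
                     (ColumnEquation-∑ (tail X) (tail Y) (tail Z) (eqs ∘ Data.Fin.suc))

  ColumnEquation-geometric : ∀ x n → ColumnEquation x (∑[ v < suc n ] (x ^ suc (toℕ v))) 1# (x ^ n)
  ColumnEquation-geometric x n = begin
    ∑[ v < suc n ] (x ^ suc (toℕ v)) + x ^ suc (suc n)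
      ≡⟨ ≡.cong₂ _+_ (sum-cong-≗ {suc n} (λ v → ≡.cong (λ j → x ^ suc j) (≡.sym (toℕ-inject₁ v))))
                     (≡.cong (λ j → x ^ suc j) (≡.sym (toℕ-fromℕ (suc n)))) ⟩
    ∑[ v < suc n ] (x ^ suc (toℕ (inject₁ v))) + x ^ suc (toℕ (fromℕ (suc n)))
      ≈⟨ sym (sum-init-last {suc n} (λ v → x ^ suc (toℕ v))) ⟩
    ∑[ v < suc (suc n) ] (x ^ suc (toℕ v))
      ≈⟨ +-congˡ (sym (*-distribˡ-sum {suc n} x (λ v → x ^ suc (toℕ v)))) ⟩
    x * 1# + x * ∑[ v < suc n ] (x ^ suc (toℕ v)) ∎

  ^-zeroˡ : ∀ n → 1# ^ n ≈ 1#
  ^-zeroˡ zero    = refl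
  ^-zeroˡ (suc n) = trans (*-identityˡ _) (^-zeroˡ n)

  catFromSum-columnEquation : ∀ k p y z u → ColumnEquation (y * u)
    (catFromSum (suc k) p y z u) (catFromSum k p z y 1#) (catFromSum k p z y (y * u))
  catFromSum-columnEquation zero    p y z u =
    ColumnEquation-resp (sum-cong-≋ {suc (suc p)} (λ v → ^-distrib-* y u (suc (toℕ v))))
                        (sym (^-zeroˡ (suc p))) refl
                        (ColumnEquation-geometric (y * u) (suc p))
  catFromSum-columnEquation (suc k) p y z u = ColumnEquation-∑ {n = suc (suc p)} _ _ _ (λ v →
    ColumnEquation-*ˡ (ifEven k z y ^ suc (toℕ v)) (catFromSum-columnEquation k (toℕ v) y z u))

  catalanSum-columnEquation : ∀ k y z u → ColumnEquation (y * u)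
    (catalanSum (suc (suc k)) y z u) (catalanSum (suc k) z y 1#) (catalanSum (suc k) z y (y * u))
  catalanSum-columnEquation k y z u =
    ColumnEquation-resp (sym (catalanSum-suc (suc k) y z u)) (sym (catalanSum-suc k z y 1#))
                        (sym (catalanSum-suc k z y (y * u)))
                        (ColumnEquation-*ˡ (ifEven k z y) (catFromSum-columnEquation k 0 y z u))

module CatalanRecurrence {c ℓ} (R : CommutativeRing c ℓ) where
  open CommutativeRing R
  open CatalanSums commutativeSemiring
  open import Algebra.Properties.Semiring.Exp semiring using (_^_)
  open import Algebra.Properties.Ring ring using ([y-z]x≈yx-zx; x[y-z]≈xy-xz)
  open import Algebra.Solver.Ring.NaturalCoefficients.Default commutativeSemiring
  open import Relation.Binary.Reasoning.Setoid setoid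

  pow≡^ : ∀ a n → pow R a n ≡ a ^ n
  pow≡^ a zero    = ≡.refl
  pow≡^ a (suc n) = ≡.cong (a *_) (pow≡^ a n)

  Ccoeff≡catalanSum : ∀ n y z u → Ccoeff R n y z u ≡ catalanSum n y z u
  Ccoeff≡catalanSum n y z u = ≡.cong (foldr _+_ 0#) (map-cong weight≡ (catalanWords n))
    where
    weight≡ : ∀ w → pow R y (s w) * (pow R z (sbar w) * pow R u (last w)) ≡ catalanWeight y z u w
    weight≡ w = ≡.cong₂ _*_ (pow≡^ y (s w)) (≡.cong₂ _*_ (pow≡^ z (sbar w)) (pow≡^ u (last w)))

  Ccoeff-columnEquation : ∀ k y z u → ColumnEquation (y * u)
    (Ccoeff R (suc (suc k)) y z u) (Ccoeff R (suc k) z y 1#) (Ccoeff R (suc k) z y (y * u))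
  Ccoeff-columnEquation k y z u = ColumnEquation-resp
    (reflexive (≡.sym (Ccoeff≡catalanSum (suc (suc k)) y z u)))
    (reflexive (≡.sym (Ccoeff≡catalanSum (suc k) z y 1#)))
    (reflexive (≡.sym (Ccoeff≡catalanSum (suc k) z y (y * u))))
    (catalanSum-columnEquation k y z u)

  Ccoeff-1 : ∀ y z u w → Ccoeff R 1 y z u ≈ y * u + y * u * w * (0# - y * u * 0#)
  Ccoeff-1 y z u w = begin
    -- the weight of the only Catalan word of length 1
    y * 1# * (1# * (u * 1#)) + 0#
      ≈⟨ solve 2 (λ y u → y :* con 1 :* (con 1 :* (u :* con 1)) :+ con 0 := y :* u :+ con 0)
                 refl y u ⟩
    y * u + 0#
      ≈⟨ +-congˡ (sym (trans (*-congˡ (trans (+-congˡ (-‿cong (zeroʳ _))) (-‿inverseʳ 0#)))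
                             (zeroʳ _))) ⟩
    y * u + y * u * w * (0# - y * u * 0#) ∎

  +-exchange-− : ∀ {a b c d} → a + b ≈ c + d → a - d ≈ c - b
  +-exchange-− {a} {b} {c} {d} a+b≈c+d = begin
    a - d                     ≈⟨ sym (+-identityʳ _) ⟩
    (a - d) + 0#              ≈⟨ +-congˡ (sym (-‿inverseʳ b)) ⟩
    (a + - d) + (b + - b)     ≈⟨ solve 4 (λ a b nd nb → (a :+ nd) :+ (b :+ nb) := (a :+ b) :+ (nd :+ nb))
                                         refl a b (- d) (- b) ⟩
    (a + b) + (- d + - b)     ≈⟨ +-congʳ a+b≈c+d ⟩
    (c + d) + (- d + - b)     ≈⟨ solve 4 (λ c d nd nb → (c :+ d) :+ (nd :+ nb) := (c :+ nb) :+ (d :+ nd))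
                                         refl c d (- d) (- b) ⟩
    (c + - b) + (d + - d)     ≈⟨ +-congˡ (-‿inverseʳ d) ⟩
    (c - b) + 0#              ≈⟨ +-identityʳ _ ⟩
    c - b                     ∎

  ColumnEquation-solve : ∀ {w x X Y Z} → w * (1# - x) ≈ 1# → ColumnEquation x X Y Z →
    X ≈ x * w * (Y - x * Z)
  ColumnEquation-solve {w} {x} {X} {Y} {Z} w*[1-x]≈1 eq = begin
    X                         ≈⟨ sym (*-identityˡ X) ⟩
    1# * X                    ≈⟨ *-congʳ (sym w*[1-x]≈1) ⟩
    w * (1# - x) * X          ≈⟨ *-assoc w _ X ⟩
    w * ((1# - x) * X)        ≈⟨ *-congˡ (trans ([y-z]x≈yx-zx X 1# x) (+-congʳ (*-identityˡ X))) ⟩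
    w * (X - x * X)           ≈⟨ *-congˡ (+-exchange-− eq) ⟩
    w * (x * Y - x * (x * Z)) ≈⟨ *-congˡ (sym (x[y-z]≈xy-xz x Y (x * Z))) ⟩
    w * (x * (Y - x * Z))     ≈⟨ trans (sym (*-assoc w x _)) (*-congʳ (*-comm w x)) ⟩
    x * w * (Y - x * Z)       ∎

theorem5p1 : ∀ {c ℓ} (R : CommutativeRing c ℓ) →
    let open CommutativeRing R in
    (y z u w : Carrier) → w * (1# - y * u) ≈ 1# →
    (Ccoeff R 0 y z u ≈ 0#) ×
    ((n : ℕ) →
      Ccoeff R (suc n) y z u
        ≈ xyuCoeff R n y u
          + (y * u) * w * (Ccoeff R n z y 1# - (y * u) * Ccoeff R n z y (y * u)))
theorem5p1 R y z u w w*[1-yu]≈1 = refl , recurrence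
  where
  open CommutativeRing R
  open CatalanRecurrence R
  recurrence : (n : ℕ) → Ccoeff R (suc n) y z u
    ≈ xyuCoeff R n y u + (y * u) * w * (Ccoeff R n z y 1# - (y * u) * Ccoeff R n z y (y * u))
  recurrence zero    = Ccoeff-1 y z u w
  recurrence (suc k) =
    trans (ColumnEquation-solve w*[1-yu]≈1 (Ccoeff-columnEquation k y z u)) (sym (+-identityˡ _))
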